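{- Let $G$ be a theta-free graph and let $P=p_1\hbox{ - }\cdots\hbox{ - }p_k$ be a path in $G$. Let $D$ be a connected subset of $V(G)$ such that $D$ is anticomplete to $P$. Let $x,y\in N(P)\cap N(D)$ be such that $xy$ is not an edge, and assume that each of $x$ and $y$ has at least two non-adjacent neighbors in $P$. Let $i_x$ be minimum and $j_x$ be maximum such that $x$ is adjacent to $p_{i_x}$ and $p_{j_x}$, and write $P_x=p_{i_x}\hbox{ - }P\hbox{ - }p_{j_x}$. Suppose that $y$ has a neighbor in $P_x$. Then $y$ has a neighbor in $N_{P_x}[p_{i_x}]\cup N_{P_x}[p_{j_x}]$.
   Context: Graphs are finite and simple; a path in $G$ is an induced subgraph that is a path, and $p_i\hbox{ - }P\hbox{ - }p_j$ denotes the subpath of $P$ between $p_i$ and $p_j$. A theta is a graph consisting of three internally vertex-disjoint paths between two vertices, each of length at least 2, with pairwise anticomplete interiors; theta-free means no induced theta. For $Z\subseteq V(G)$, $N(Z)$ is the set of vertices not in $Z$ having a neighbor in $Z$. For an induced subgraph $H$ and vertex $v$, $N_H[v]$ is the set consisting of $v$ (if in $H$) and the neighbors of $v$ in $H$. Two sets are anticomplete if there is no edge between them. -}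

module Defs where

open import Data.Nat using (ℕ; zero; suc; _+_; _<_; _≤_)
open import Data.Fin using (Fin; toℕ; fromℕ)
open import Data.Product using (Σ; ∃; _×_; _,_)
open import Data.Sum using (_⊎_)
open import Relation.Nullary using (¬_)
open import Relation.Binary.PropositionalEquality using (_≡_; _≢_)
open import Relation.Binary using (Decidable)
open import Function.Definitions using (Injective)

record Graph : Set₁ where
  field
    n     : ℕ
    Adj   : Fin n → Fin n → Set
    adj?  : Decidable Adj
    sym   : ∀ {u v} → Adj u v → Adj v u
    irrefl : ∀ {u} → ¬ Adj u u

module _ (G : Graph) where
  open Graph G

  V : Set
  V = Fin n

  IsPath : (k : ℕ) → (Fin k → V) → Set
  IsPath k p = Injective _≡_ _≡_ p
             × (∀ i j → (Adj (p i) (p j) → (suc (toℕ i) ≡ toℕ j ⊎ suc (toℕ j) ≡ toℕ i))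
                      × ((suc (toℕ i) ≡ toℕ j ⊎ suc (toℕ j) ≡ toℕ i) → Adj (p i) (p j)))

  Inner : (m : ℕ) → Fin (3 + m) → Set
  Inner m i = 0 < toℕ i × toℕ i < 2 + m

  InnerAnti : ∀ m₁ m₂ → (Fin (3 + m₁) → V) → (Fin (3 + m₂) → V) → Set
  InnerAnti m₁ m₂ P Q = ∀ i j → Inner m₁ i → Inner m₂ j → (P i ≢ Q j) × ¬ Adj (P i) (Q j)

  -- a path from a to b of length at least 2 (at least 3 vertices)
  PathBetween : V → V → (m : ℕ) → (Fin (3 + m) → V) → Set
  PathBetween a b m P = IsPath (3 + m) P × (P Data.Fin.zero ≡ a) × (P (fromℕ (2 + m)) ≡ b)

  record Theta : Set where
    field
      a b : V
      m₁ m₂ m₃ : ℕ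
      P₁ : Fin (3 + m₁) → V
      P₂ : Fin (3 + m₂) → V
      P₃ : Fin (3 + m₃) → V
      path₁ : PathBetween a b m₁ P₁
      path₂ : PathBetween a b m₂ P₂
      path₃ : PathBetween a b m₃ P₃
      anti₁₂ : InnerAnti m₁ m₂ P₁ P₂
      anti₁₃ : InnerAnti m₁ m₃ P₁ P₃
      anti₂₃ : InnerAnti m₂ m₃ P₂ P₃

  ThetaFree : Set
  ThetaFree = ¬ Theta

  data WalkIn (D : V → Set) : V → V → Set where
    here : ∀ {u} → D u → WalkIn D u u
    step : ∀ {u v w} → D u → Adj u v → WalkIn D v w → WalkIn D u w

  Connected : (V → Set) → Set
  Connected D = (∃ λ u → D u) × (∀ u v → D u → D v → WalkIn D u v)

  Anticomplete : (V → Set) → (V → Set) → Set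
  Anticomplete A B = ∀ u v → A u → B v → ¬ Adj u v

  InN : (V → Set) → V → Set
  InN Z v = ¬ Z v × (∃ λ z → Z z × Adj v z)

  VertsOf : ∀ {k} → (Fin k → V) → V → Set
  VertsOf {k} p v = ∃ λ (i : Fin k) → p i ≡ v

module Submission where

-- Let Q be an induced x–y path with interior in D (it exists since D is connected), and
-- suppose y has a neighbour p_m with i_x + 2 ≤ m ≤ j_x − 2. Every pair of an x-neighbour
-- and a y-neighbour on P yields an induced x–y path with interior in the subpath of P
-- between them. If y has a neighbour p_i before p_{i_x}, the paths through p_i … p_{i_x}
-- and p_m … p_{j_x} have interiors at distance at least 2 on P; likewise for a neighbour
-- after p_{j_x}; otherwise y's two non-adjacent neighbours p_i, p_j (i < j) lie in P_x and
-- p_{i_x} … p_i, p_j … p_{j_x} work. Together with Q this is a theta.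

open import Defs
open import Data.Nat using (ℕ; zero; suc; pred; _+_; _∸_; _≤_; _<_; _≤?_; _<?_; z≤n; s≤s; z<s; s≤s⁻¹)
open import Data.Nat.Properties
open import Data.Fin using (Fin; toℕ; fromℕ; fromℕ<)
open import Data.Fin.Properties using (toℕ-injective; toℕ-fromℕ; toℕ-fromℕ<; toℕ≤pred[n]; fromℕ<-toℕ)
  renaming (_≟_ to _≟ᶠ_)
open import Data.Product using (Σ; ∃; _×_; _,_; proj₁; proj₂)
open import Data.Sum using (_⊎_; inj₁; inj₂; [_,_]′)
open import Data.Empty using (⊥; ⊥-elim)
open import Relation.Nullary using (¬_; Dec; yes; no; contradiction)
open import Relation.Nullary.Decidable using (_⊎-dec_)
open import Relation.Binary.Definitions using (tri<; tri≈; tri>)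
open import Relation.Binary.PropositionalEquality using (_≡_; _≢_; refl; sym; trans; cong; subst; subst₂; module ≡-Reasoning)

greatest : {Q : ℕ → Set} → (∀ t → Dec (Q t)) → ∀ {t₀} L → t₀ ≤ L → Q t₀ →
           ∃ λ t → t ≤ L × Q t × (∀ {t′} → t < t′ → t′ ≤ L → ¬ Q t′)
greatest Q? zero z≤n q = 0 , z≤n , q , λ 0<t′ t′≤0 _ → <⇒≱ 0<t′ t′≤0
greatest {Q} Q? (suc L) t₀≤ q with Q? (suc L)
... | yes qL = suc L , ≤-refl , qL , λ L<t′ t′≤L _ → <⇒≱ L<t′ t′≤L
... | no ¬qL with m≤n⇒m<n∨m≡n t₀≤
...   | inj₂ refl = contradiction q ¬qL
...   | inj₁ (s≤s t₀≤L) with greatest Q? L t₀≤L q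
...     | t , t≤L , qt , above = t , m≤n⇒m≤1+n t≤L , qt , beyond
  where
  beyond : ∀ {t′} → t < t′ → t′ ≤ suc L → ¬ Q t′
  beyond t<t′ t′≤ = [ (λ t′<  → above t<t′ (s≤s⁻¹ t′<)) , (λ { refl → ¬qL }) ]′ (m≤n⇒m<n∨m≡n t′≤)

Consecutive : ℕ → ℕ → Set
Consecutive i j = suc i ≡ j ⊎ suc j ≡ i

far⇒¬consecutive : ∀ {i j} → suc (suc i) ≤ j → ¬ Consecutive i j
far⇒¬consecutive i+2≤j (inj₁ refl) = 1+n≰n i+2≤j
far⇒¬consecutive i+2≤j (inj₂ refl) = 1+n≰n (m+n≤o⇒n≤o 2 i+2≤j)

apart : ∀ {i j} → i ≢ j → ¬ Consecutive i j → suc (suc i) ≤ j ⊎ suc (suc j) ≤ i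
apart {i} {j} i≢j ¬i~j with <-cmp i j
... | tri< i<j _ _ = inj₁ (≤∧≢⇒< i<j (λ e → ¬i~j (inj₁ e)))
... | tri≈ _ i≡j _ = contradiction i≡j i≢j
... | tri> _ _ j<i = inj₂ (≤∧≢⇒< j<i (λ e → ¬i~j (inj₂ e)))

position : ∀ {I m J} → I ≤ m → m ≤ J →
           (m ≡ I ⊎ Consecutive m I) ⊎ (m ≡ J ⊎ Consecutive m J) ⊎ (suc (suc I) ≤ m × suc (suc m) ≤ J)
position I≤m m≤J with m≤n⇒m<n∨m≡n I≤m
... | inj₂ refl = inj₁ (inj₁ refl)
... | inj₁ I<m with m≤n⇒m<n∨m≡n I<m
...   | inj₂ 1+I≡m = inj₁ (inj₂ (inj₂ 1+I≡m))
...   | inj₁ I+1<m with m≤n⇒m<n∨m≡n m≤J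
...     | inj₂ refl = inj₂ (inj₁ (inj₁ refl))
...     | inj₁ m<J with m≤n⇒m<n∨m≡n m<J
...       | inj₂ 1+m≡J = inj₂ (inj₁ (inj₂ (inj₁ 1+m≡J)))
...       | inj₁ m+1<J = inj₂ (inj₂ (I+1<m , m+1<J))

module _ (G : Graph) where
  open Graph G renaming (sym to adj-sym)

  -- s 0, …, s L (L is the length, not the number of vertices) is an induced path.
  record IsInduced (L : ℕ) (s : ℕ → V G) : Set where
    field
      injective            : ∀ {i j} → i ≤ L → j ≤ L → s i ≡ s j → i ≡ j
      adjacent⇒consecutive : ∀ {i j} → i ≤ L → j ≤ L → Adj (s i) (s j) → Consecutive i j
      adjacent-suc         : ∀ {i} → i < L → Adj (s i) (s (suc i))

    consecutive⇒adjacent : ∀ {i j} → i ≤ L → j ≤ L → Consecutive i j → Adj (s i) (s j)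
    consecutive⇒adjacent _ j≤L (inj₁ refl) = adjacent-suc j≤L
    consecutive⇒adjacent i≤L _ (inj₂ refl) = adj-sym (adjacent-suc i≤L)

  open IsInduced

  induced⇒isPath : ∀ {L s} → IsInduced L s → IsPath G (suc L) (λ i → s (toℕ i))
  induced⇒isPath ind =
      (λ e → toℕ-injective (injective ind (toℕ≤pred[n] _) (toℕ≤pred[n] _) e))
    , λ i j → adjacent⇒consecutive ind (toℕ≤pred[n] i) (toℕ≤pred[n] j)
            , consecutive⇒adjacent ind (toℕ≤pred[n] i) (toℕ≤pred[n] j)

  -- Reads a vertex sequence indexed by Fin (suc L) as one indexed by ℕ;
  -- indices beyond L give the junk value p L.
  at : ∀ {L} → (Fin (suc L) → V G) → ℕ → V G
  at {L} p i with i ≤? L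
  ... | yes i≤L = p (fromℕ< (s≤s i≤L))
  ... | no _    = p (fromℕ L)

  at-fromℕ< : ∀ {L} (p : Fin (suc L) → V G) {i} (i≤L : i ≤ L) → at p i ≡ p (fromℕ< (s≤s i≤L))
  at-fromℕ< {L} p {i} i≤L with i ≤? L
  ... | yes _   = refl
  ... | no i≰L = contradiction i≤L i≰L

  at-toℕ : ∀ {L} (p : Fin (suc L) → V G) f → at p (toℕ f) ≡ p f
  at-toℕ p f = trans (at-fromℕ< p (toℕ≤pred[n] f)) (cong p (fromℕ<-toℕ f _))

  isPath⇒induced : ∀ {L p} → IsPath G (suc L) p → IsInduced L (at p)
  isPath⇒induced {L} {p} (p-injective , p-adjacent) = record
    { injective            = λ i≤L j≤L e →
        trans (sym (toℕ-fromℕ< (s≤s i≤L)))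
              (trans (cong toℕ (p-injective (same-vertex i≤L e j≤L))) (toℕ-fromℕ< (s≤s j≤L)))
    ; adjacent⇒consecutive = λ i≤L j≤L a →
        subst₂ Consecutive (toℕ-fromℕ< (s≤s i≤L)) (toℕ-fromℕ< (s≤s j≤L))
          (proj₁ (p-adjacent _ _) (subst₂ Adj (at-fromℕ< p i≤L) (at-fromℕ< p j≤L) a))
    ; adjacent-suc         = λ {i} i<L →
        subst₂ Adj (sym (at-fromℕ< p (<⇒≤ i<L))) (sym (at-fromℕ< p i<L))
          (proj₂ (p-adjacent _ _)
            (inj₁ (trans (cong suc (toℕ-fromℕ< (s≤s (<⇒≤ i<L)))) (sym (toℕ-fromℕ< (s≤s i<L))))))
    }
    where
    same-vertex : ∀ {i j} (i≤L : i ≤ L) → at p i ≡ at p j → (j≤L : j ≤ L) →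
             p (fromℕ< (s≤s i≤L)) ≡ p (fromℕ< (s≤s j≤L))
    same-vertex i≤L e j≤L = trans (sym (at-fromℕ< p i≤L)) (trans e (at-fromℕ< p j≤L))

  restrict : ∀ {L M s} → M ≤ L → IsInduced L s → IsInduced M s
  restrict M≤L ind = record
    { injective            = λ i≤M j≤M → injective ind (≤-trans i≤M M≤L) (≤-trans j≤M M≤L)
    ; adjacent⇒consecutive = λ i≤M j≤M → adjacent⇒consecutive ind (≤-trans i≤M M≤L) (≤-trans j≤M M≤L)
    ; adjacent-suc         = λ i<M → adjacent-suc ind (≤-trans i<M M≤L)
    }

  reverse-consecutive : ∀ {L i j} → i ≤ L → suc (L ∸ i) ≡ L ∸ j → suc j ≡ i
  reverse-consecutive {L} {i} {j} i≤L e = ∸-cancelˡ-≡ j<L i≤L (begin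
    L ∸ suc j     ≡⟨ sym (pred[m∸n]≡m∸[1+n] L j) ⟩
    pred (L ∸ j)  ≡⟨ cong pred (sym e) ⟩
    L ∸ i         ∎)
    where
    open ≡-Reasoning
    j<L : j < L
    j<L = m∸n≢0⇒n<m (λ L∸j≡0 → 1+n≢0 (trans e L∸j≡0))

  reverse-induced : ∀ {L s} → IsInduced L s → IsInduced L (λ i → s (L ∸ i))
  reverse-induced {L} {s} ind = record
    { injective            = λ {i} {j} i≤L j≤L e →
        ∸-cancelˡ-≡ i≤L j≤L (injective ind (m∸n≤m L i) (m∸n≤m L j) e)
    ; adjacent⇒consecutive = λ {i} {j} i≤L j≤L a →
        flip i≤L j≤L (adjacent⇒consecutive ind (m∸n≤m L i) (m∸n≤m L j) a)
    ; adjacent-suc         = λ {i} i<L →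
        let L∸i≡ = +-∸-assoc 1 i<L in
        subst (λ k → Adj (s k) (s (L ∸ suc i))) (sym L∸i≡)
          (adj-sym (adjacent-suc ind (subst (_≤ L) L∸i≡ (m∸n≤m L i))))
    }
    where
    flip : ∀ {i j} → i ≤ L → j ≤ L → Consecutive (L ∸ i) (L ∸ j) → Consecutive i j
    flip i≤L _   (inj₁ e) = inj₂ (reverse-consecutive i≤L e)
    flip _   j≤L (inj₂ e) = inj₁ (reverse-consecutive j≤L e)

  suffix-bound : ∀ {L t i} → t ≤ L → i ≤ L ∸ t → i + t ≤ L
  suffix-bound t≤L i≤ = subst (_ ≤_) (m∸n+n≡m t≤L) (+-monoˡ-≤ _ i≤)

  suffix-induced : ∀ {L s t} → t ≤ L → IsInduced L s → IsInduced (L ∸ t) (λ i → s (i + t))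
  suffix-induced {t = t} t≤L ind = record
    { injective            = λ i≤ j≤ e →
        +-cancelʳ-≡ t _ _ (injective ind (suffix-bound t≤L i≤) (suffix-bound t≤L j≤) e)
    ; adjacent⇒consecutive = λ i≤ j≤ a → unshift (adjacent⇒consecutive ind (suffix-bound t≤L i≤) (suffix-bound t≤L j≤) a)
    ; adjacent-suc         = λ i< → adjacent-suc ind (suffix-bound t≤L i<)
    }
    where
    unshift : ∀ {i j} → Consecutive (i + t) (j + t) → Consecutive i j
    unshift (inj₁ e) = inj₁ (+-cancelʳ-≡ t _ _ e)
    unshift (inj₂ e) = inj₂ (+-cancelʳ-≡ t _ _ e)

  _◃_ : V G → (ℕ → V G) → ℕ → V G
  (u ◃ s) zero    = u
  (u ◃ s) (suc i) = s i

  cons-induced : ∀ {L s u} → IsInduced L s → Adj u (s 0) → (∀ {i} → i ≤ L → s i ≢ u) →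
                 (∀ {i} → 0 < i → i ≤ L → ¬ Adj u (s i)) → IsInduced (suc L) (u ◃ s)
  cons-induced {L} {s} {u} ind u~s₀ u∉s u≁s = record
    { injective            = inj
    ; adjacent⇒consecutive = adj
    ; adjacent-suc         = λ { {zero} _ → u~s₀ ; {suc i} i< → adjacent-suc ind (s≤s⁻¹ i<) }
    }
    where
    only-first : ∀ {j} → j ≤ L → Adj u (s j) → suc 0 ≡ suc j
    only-first {zero}  _   _ = refl
    only-first {suc j} j≤L a = contradiction a (u≁s z<s j≤L)
    inj : ∀ {i j} → i ≤ suc L → j ≤ suc L → (u ◃ s) i ≡ (u ◃ s) j → i ≡ j
    inj {zero}  {zero}  _  _  _ = refl
    inj {zero}  {suc j} _  j≤ e = contradiction (sym e) (u∉s (s≤s⁻¹ j≤))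
    inj {suc i} {zero}  i≤ _  e = contradiction e (u∉s (s≤s⁻¹ i≤))
    inj {suc i} {suc j} i≤ j≤ e = cong suc (injective ind (s≤s⁻¹ i≤) (s≤s⁻¹ j≤) e)
    adj : ∀ {i j} → i ≤ suc L → j ≤ suc L → Adj ((u ◃ s) i) ((u ◃ s) j) → Consecutive i j
    adj {zero}  {zero}  _  _  a = contradiction a irrefl
    adj {zero}  {suc j} _  j≤ a = inj₁ (only-first (s≤s⁻¹ j≤) a)
    adj {suc i} {zero}  i≤ _  a = inj₂ (only-first (s≤s⁻¹ i≤) (adj-sym a))
    adj {suc i} {suc j} i≤ j≤ a with adjacent⇒consecutive ind (s≤s⁻¹ i≤) (s≤s⁻¹ j≤) a
    ... | inj₁ e = inj₁ (cong suc e)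
    ... | inj₂ e = inj₂ (cong suc e)

  singleton-induced : ∀ {u} → IsInduced 0 (λ _ → u)
  singleton-induced = record
    { injective            = λ { z≤n z≤n _ → refl }
    ; adjacent⇒consecutive = λ _ _ a → contradiction a irrefl
    ; adjacent-suc         = λ ()
    }

  record Path (a b : V G) : Set where
    constructor path
    field
      len     : ℕ
      vert    : ℕ → V G
      induced : IsInduced len vert
      first   : vert 0 ≡ a
      last    : vert len ≡ b

  open Path

  Within : ∀ {a b} → Path a b → (V G → Set) → Set
  Within P Z = ∀ {i} → i ≤ len P → Z (vert P i)

  Interior : ∀ {a b} → Path a b → (V G → Set) → Set
  Interior P Z = ∀ {i} → 0 < i → i < len P → Z (vert P i)

  Ends : V G → V G → (V G → Set) → V G → Set
  Ends a b Z v = v ≡ a ⊎ v ≡ b ⊎ Z v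

  interior : ∀ {a b Z} (P : Path a b) → Within P (Ends a b Z) → Interior P Z
  interior P within {i} 0<i i<len with within (<⇒≤ i<len)
  ... | inj₁ e         = ⊥-elim (<⇒≢ 0<i (sym (injective (induced P) (<⇒≤ i<len) z≤n (trans e (sym (first P))))))
  ... | inj₂ (inj₁ e)  = ⊥-elim (<⇒≢ i<len (injective (induced P) (<⇒≤ i<len) ≤-refl (trans e (sym (last P)))))
  ... | inj₂ (inj₂ z)  = z

  singleton : ∀ a → Path a a
  singleton a = path 0 (λ _ → a) singleton-induced refl refl

  reverse : ∀ {a b} → Path a b → Path b a
  reverse P = path (len P) (λ i → vert P (len P ∸ i)) (reverse-induced (induced P))
                   (last P) (trans (cong (vert P) (n∸n≡0 (len P))) (first P))

  reverse-within : ∀ {a b Z} (P : Path a b) → Within P Z → Within (reverse P) Z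
  reverse-within P within {i} _ = within (m∸n≤m (len P) i)

  reverse-interior : ∀ {a b Z} (P : Path a b) → Interior P Z → Interior (reverse P) Z
  reverse-interior P int 0<i i<len = int (m<n⇒0<n∸m i<len) (∸-monoʳ-< 0<i (<⇒≤ i<len))

  suffix : ∀ {a b} (P : Path a b) {t} → t ≤ len P → Path (vert P t) b
  suffix P {t} t≤len = path (len P ∸ t) (λ i → vert P (i + t)) (suffix-induced t≤len (induced P))
                            refl (trans (cong (vert P) (m∸n+n≡m t≤len)) (last P))

  cons : ∀ {a b u} (P : Path a b) → Adj u a → (∀ {i} → i ≤ len P → vert P i ≢ u) →
         (∀ {i} → 0 < i → i ≤ len P → ¬ Adj u (vert P i)) → Path u b
  cons {u = u} P u~a u∉P u≁P =
    path (suc (len P)) (u ◃ vert P) (cons-induced (induced P) (subst (Adj u) (sym (first P)) u~a) u∉P u≁P)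
         refl (last P)

  -- u followed by P from the last vertex of P in the closed neighbourhood of u;
  -- this is induced since u sees nothing beyond that vertex.
  prepend : ∀ {a b u} (P : Path a b) → Adj u a →
            Σ (Path u b) λ P′ → ∀ {Z} → Z u → Within P Z → Within P′ Z
  prepend {u = u} P u~a
    with greatest (λ t → (u ≟ᶠ vert P t) ⊎-dec adj? u (vert P t)) (len P) z≤n
                  (inj₂ (subst (Adj u) (sym (first P)) u~a))
  ... | t , t≤len , inj₁ refl , _ =
    suffix P t≤len , λ _ within i≤ → within (suffix-bound t≤len i≤)
  ... | t , t≤len , inj₂ u~t , beyond =
    cons (suffix P t≤len) u~t u∉ u≁ , λ { u∈Z within {zero} _ → u∈Z
                                        ; u∈Z within {suc i} i≤ → within (suffix-bound t≤len (s≤s⁻¹ i≤)) }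
    where
    u∉ : ∀ {i} → i ≤ len P ∸ t → vert P (i + t) ≢ u
    u∉ {zero}  _  e = irrefl (subst (Adj u) e u~t)
    u∉ {suc i} i≤ e = beyond (s≤s (m≤n+m t i)) (suffix-bound t≤len i≤) (inj₁ (sym e))
    u≁ : ∀ {i} → 0 < i → i ≤ len P ∸ t → ¬ Adj u (vert P (i + t))
    u≁ {suc i} _ i≤ a = beyond (s≤s (m≤n+m t i)) (suffix-bound t≤len i≤) (inj₂ a)

  path-through : ∀ {D x y z₁ z₂} → Adj x z₁ → Adj y z₂ → WalkIn G D z₁ z₂ →
                 Σ (Path x y) λ Q → Interior Q D
  path-through {D} {x} {y} x~z₁ y~z₂ walk =
    let Q , within = extend (inj₁ refl) x~z₁ (to-y walk (adj-sym y~z₂)) in Q , interior {Z = D} Q within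
    where
    Along : V G → Set
    Along z = Σ (Path z y) λ P → Within P (Ends x y D)
    extend : ∀ {u a} → Ends x y D u → Adj u a → Along a → Along u
    extend u∈ u~a (P , within) = proj₁ (prepend P u~a) , proj₂ (prepend P u~a) u∈ within
    to-y : ∀ {z w} → WalkIn G D z w → Adj w y → Along z
    to-y (here z∈D)          z~y = extend (inj₂ (inj₂ z∈D)) z~y (singleton y , λ _ → inj₂ (inj₁ refl))
    to-y (step u∈D u~v walk) w~y = extend (inj₂ (inj₂ u∈D)) u~v (to-y walk w~y)

  Separated : (V G → Set) → (V G → Set) → Set
  Separated Z Z′ = ∀ {u v} → Z u → Z′ v → u ≢ v × ¬ Adj u v

  record Leg (a b : V G) (Z : V G → Set) : Set where
    field
      m            : ℕ
      vertex       : Fin (3 + m) → V G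
      path-between : PathBetween G a b m vertex
      inner        : ∀ i → Inner G m i → Z (vertex i)

  leg : ∀ {a b Z} → a ≢ b → ¬ Adj a b → (P : Path a b) → Interior P Z → Leg a b Z
  leg a≢b _ (path zero _ _ first last) _ = contradiction (trans (sym first) last) a≢b
  leg _ a≁b (path (suc zero) _ ind first last) _ = contradiction (subst₂ Adj first last (adjacent-suc ind z<s)) a≁b
  leg _ _ (path (suc (suc m)) v ind first last) int = record
    { m            = m
    ; vertex       = λ i → v (toℕ i)
    ; path-between = induced⇒isPath ind , first , trans (cong v (toℕ-fromℕ _)) last
    ; inner        = λ _ (0<i , i<len) → int 0<i i<len
    }

  theta : ∀ {a b Z₁ Z₂ Z₃} → Leg a b Z₁ → Leg a b Z₂ → Leg a b Z₃ →
          Separated Z₁ Z₂ → Separated Z₁ Z₃ → Separated Z₂ Z₃ → Theta G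
  theta P₁ P₂ P₃ sep₁₂ sep₁₃ sep₂₃ = record
    { path₁  = Leg.path-between P₁
    ; path₂  = Leg.path-between P₂
    ; path₃  = Leg.path-between P₃
    ; anti₁₂ = λ i j i∈ j∈ → sep₁₂ (Leg.inner P₁ i i∈) (Leg.inner P₂ j j∈)
    ; anti₁₃ = λ i j i∈ j∈ → sep₁₃ (Leg.inner P₁ i i∈) (Leg.inner P₃ j j∈)
    ; anti₂₃ = λ i j i∈ j∈ → sep₂₃ (Leg.inner P₂ i i∈) (Leg.inner P₃ j j∈)
    }

  module Segments {L s} (s-induced : IsInduced L s) where

    InSegment : ℕ → ℕ → V G → Set
    InSegment lo hi v = ∃ λ i → i ≤ L × lo ≤ i × i ≤ hi × s i ≡ v

    subpath : ∀ {lo hi} → lo ≤ hi → hi ≤ L → Σ (Path (s lo) (s hi)) λ P → Within P (InSegment lo hi)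
    subpath {lo} {hi} lo≤hi hi≤L =
      suffix (path hi s (restrict hi≤L s-induced) refl refl) lo≤hi ,
      λ {i} i≤ → let i+lo≤hi = suffix-bound lo≤hi i≤ in
                 i + lo , ≤-trans i+lo≤hi hi≤L , m≤n+m lo i , i+lo≤hi , refl

    segment-path : ∀ {lo hi u w} → lo ≤ hi → hi ≤ L → Adj u (s lo) → Adj w (s hi) →
                   Σ (Path u w) λ P → Interior P (InSegment lo hi)
    segment-path {lo} {hi} {u} {w} lo≤hi hi≤L u~lo w~hi = P₂ , interior {Z = InSegment lo hi} P₂ P₂-within
      where
      Z : V G → Set
      Z = Ends u w (InSegment lo hi)
      r : Path (s lo) (s hi)
      r = proj₁ (subpath lo≤hi hi≤L)
      r-within : Within r Z
      r-within i≤ = inj₂ (inj₂ (proj₂ (subpath lo≤hi hi≤L) i≤))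
      P₁ : Path w (s lo)
      P₁ = proj₁ (prepend (reverse r) w~hi)
      P₁-within : Within P₁ Z
      P₁-within = proj₂ (prepend (reverse r) w~hi) {Z} (inj₂ (inj₁ refl)) (reverse-within {Z = Z} r r-within)
      P₂ : Path u w
      P₂ = proj₁ (prepend (reverse P₁) u~lo)
      P₂-within : Within P₂ Z
      P₂-within = proj₂ (prepend (reverse P₁) u~lo) {Z} (inj₁ refl) (reverse-within {Z = Z} P₁ P₁-within)

    segment-path⁻ : ∀ {lo hi u w} → lo ≤ hi → hi ≤ L → Adj w (s lo) → Adj u (s hi) →
                    Σ (Path u w) λ P → Interior P (InSegment lo hi)
    segment-path⁻ {lo} {hi} lo≤hi hi≤L w~lo u~hi =
      let P , int = segment-path lo≤hi hi≤L w~lo u~hi in reverse P , reverse-interior {Z = InSegment lo hi} P int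

    segments-separated : ∀ {lo₁ hi₁ lo₂ hi₂} → suc (suc hi₁) ≤ lo₂ →
                         Separated (InSegment lo₁ hi₁) (InSegment lo₂ hi₂)
    segments-separated gap (i , i≤L , _ , i≤hi₁ , refl) (j , j≤L , lo₂≤j , _ , refl) =
        (λ e → <⇒≢ (m+n≤o⇒n≤o 1 i+2≤j) (injective s-induced i≤L j≤L e))
      , λ a → far⇒¬consecutive i+2≤j (adjacent⇒consecutive s-induced i≤L j≤L a)
      where
      i+2≤j : suc (suc i) ≤ j
      i+2≤j = ≤-trans (s≤s (s≤s i≤hi₁)) (≤-trans gap lo₂≤j)

    has-neighbour : 0 < L → ∀ {i} → i ≤ L → ∃ λ j → j ≤ L × Adj (s i) (s j)
    has-neighbour 0<L {zero}  _   = 1 , 0<L , adjacent-suc s-induced 0<L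
    has-neighbour _   {suc i} i<L = i , m+n≤o⇒n≤o 1 i<L , adj-sym (adjacent-suc s-induced i<L)

  module _ (θ-free : ThetaFree G) {L s} (s-induced : IsInduced L s) {D x y}
           (D-anti : ∀ {v k} → D v → k ≤ L → ¬ Adj v (s k)) (x≢y : x ≢ y) (x≁y : ¬ Adj x y)
           (Q : Σ (Path x y) λ Q → Interior Q D) where
    open Segments s-induced

    -- D misses the path because every vertex of it has a neighbour on it.
    D-separated : ∀ {lo hi} → 0 < L → Separated D (InSegment lo hi)
    D-separated 0<L v∈D (k , k≤L , _ , _ , refl) =
        (λ { refl → let j , j≤L , sk~sj = has-neighbour 0<L k≤L in D-anti v∈D j≤L sk~sj })
      , D-anti v∈D k≤L

    no-separated-legs : ∀ {lo₁ hi₁ lo₂ hi₂} → 0 < L → suc (suc hi₁) ≤ lo₂ →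
                        Σ (Path x y) (λ P → Interior P (InSegment lo₁ hi₁)) →
                        Σ (Path x y) (λ P → Interior P (InSegment lo₂ hi₂)) → ⊥
    no-separated-legs 0<L gap (P₁ , int₁) (P₂ , int₂) =
      θ-free (theta (leg x≢y x≁y (proj₁ Q) (proj₂ Q)) (leg x≢y x≁y P₁ int₁) (leg x≢y x≁y P₂ int₂)
                    (D-separated 0<L) (D-separated 0<L) (segments-separated gap))

    no-middle-neighbour : ∀ {I J m i j} → Adj x (s I) → Adj x (s J) → J ≤ L →
                          Adj y (s m) → suc (suc I) ≤ m → suc (suc m) ≤ J →
                          i ≤ L → j ≤ L → Adj y (s i) → Adj y (s j) → i ≢ j → ¬ Consecutive i j → ⊥
    no-middle-neighbour {I} {J} {m} x~I x~J J≤L y~m I+2≤m m+2≤J i≤L j≤L y~i y~j i≢j i≁j =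
      [ (λ i+2≤j → ordered y~i y~j i+2≤j j≤L) , (λ j+2≤i → ordered y~j y~i j+2≤i i≤L) ]′ (apart i≢j i≁j)
      where
      m≤J : m ≤ J
      m≤J = m+n≤o⇒n≤o 2 m+2≤J
      m≤L : m ≤ L
      m≤L = ≤-trans m≤J J≤L
      I≤m : I ≤ m
      I≤m = m+n≤o⇒n≤o 2 I+2≤m
      I≤L : I ≤ L
      I≤L = ≤-trans I≤m m≤L
      0<L : 0 < L
      0<L = ≤-trans (≤-trans (s≤s z≤n) I+2≤m) m≤L
      ordered : ∀ {i j} → Adj y (s i) → Adj y (s j) → suc (suc i) ≤ j → j ≤ L → ⊥
      ordered {i} {j} y~i y~j i+2≤j j≤L = split (i <? I) (J <? j)
        where
        split : Dec (i < I) → Dec (J < j) → ⊥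
        split (yes i<I) _         = no-separated-legs 0<L I+2≤m
          (segment-path⁻ (<⇒≤ i<I) I≤L y~i x~I) (segment-path⁻ m≤J J≤L y~m x~J)
        split (no _)    (yes J<j) = no-separated-legs 0<L m+2≤J
          (segment-path I≤m m≤L x~I y~m) (segment-path (<⇒≤ J<j) j≤L x~J y~j)
        split (no i≮I)  (no j≯J)  = no-separated-legs 0<L i+2≤j
          (segment-path (≮⇒≥ i≮I) (≤-trans (m+n≤o⇒n≤o 2 i+2≤j) j≤L) x~I y~i)
          (segment-path⁻ (≮⇒≥ j≯J) J≤L y~j x~J)

  near⇒close : ∀ {k p} → IsPath G k p → ∀ {f g} →
               toℕ f ≡ toℕ g ⊎ Consecutive (toℕ f) (toℕ g) → p f ≡ p g ⊎ Adj (p f) (p g)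
  near⇒close _                          (inj₁ f≡g) = inj₁ (cong _ (toℕ-injective f≡g))
  near⇒close (_ , p-adjacent) {f} {g} (inj₂ f~g) = inj₂ (proj₂ (p-adjacent f g) f~g)

  middle-neighbour-impossible :
    ∀ {L p D x y ix jx fm fi fj} → ThetaFree G → IsPath G (suc L) p → Anticomplete G D (VertsOf G p) →
    x ≢ y → ¬ Adj x y → Σ (Path x y) (λ Q → Interior Q D) →
    Adj x (p ix) → Adj x (p jx) → Adj y (p fm) →
    suc (suc (toℕ ix)) ≤ toℕ fm → suc (suc (toℕ fm)) ≤ toℕ jx →
    Adj y (p fi) → Adj y (p fj) → p fi ≢ p fj → ¬ Adj (p fi) (p fj) → ⊥
  middle-neighbour-impossible {L} {p} {ix = ix} {jx} {fm} {fi} {fj}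
    θ-free p-path D-anti x≢y x≁y Q x~ix x~jx y~fm I+2≤m m+2≤J y~fi y~fj fi≢fj fi≁fj =
    no-middle-neighbour θ-free (isPath⇒induced p-path) (λ v∈D k≤L → D-anti _ _ v∈D (at-on-path k≤L)) x≢y x≁y Q
      (adj-at ix x~ix) (adj-at jx x~jx) (toℕ≤pred[n] jx) (adj-at fm y~fm) I+2≤m m+2≤J
      (toℕ≤pred[n] fi) (toℕ≤pred[n] fj) (adj-at fi y~fi) (adj-at fj y~fj)
      (λ e → fi≢fj (cong p (toℕ-injective e))) (λ fi~fj → fi≁fj (proj₂ (proj₂ p-path fi fj) fi~fj))
    where
    adj-at : ∀ {v} f → Adj v (p f) → Adj v (at p (toℕ f))
    adj-at f = subst (Adj _) (sym (at-toℕ p f))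
    at-on-path : ∀ {k} → k ≤ L → VertsOf G p (at p k)
    at-on-path k≤L = fromℕ< (s≤s k≤L) , sym (at-fromℕ< p k≤L)

lemma5p6 : (G : Graph) → ThetaFree G →
    (k : ℕ) (p : Fin k → V G) → IsPath G k p →
    (D : V G → Set) → Connected G D → Anticomplete G D (VertsOf G p) →
    (x y : V G) →
    InN G (VertsOf G p) x → InN G D x →
    InN G (VertsOf G p) y → InN G D y →
    ¬ Graph.Adj G x y →
    (∃ λ i → ∃ λ j → Graph.Adj G x (p i) × Graph.Adj G x (p j) × p i ≢ p j × ¬ Graph.Adj G (p i) (p j)) →
    (∃ λ i → ∃ λ j → Graph.Adj G y (p i) × Graph.Adj G y (p j) × p i ≢ p j × ¬ Graph.Adj G (p i) (p j)) →
    (ix jx : Fin k) →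
    Graph.Adj G x (p ix) → Graph.Adj G x (p jx) →
    (∀ i → Graph.Adj G x (p i) → toℕ ix ≤ toℕ i × toℕ i ≤ toℕ jx) →
    (∃ λ i → toℕ ix ≤ toℕ i × toℕ i ≤ toℕ jx × Graph.Adj G y (p i)) →
    ∃ λ i → toℕ ix ≤ toℕ i × toℕ i ≤ toℕ jx × Graph.Adj G y (p i) ×
      ((p i ≡ p ix ⊎ Graph.Adj G (p i) (p ix)) ⊎ (p i ≡ p jx ⊎ Graph.Adj G (p i) (p jx)))
lemma5p6 G θ-free zero p _ D _ _ x y _ _ _ _ _ _ _ () _ _ _ _ _
lemma5p6 G θ-free (suc L) p p-path D (_ , walks) D-anti x y _ (_ , zx , zx∈D , x~zx) _ (_ , zy , zy∈D , y~zy)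
         x≁y _ (fi , fj , y~fi , y~fj , fi≢fj , fi≁fj) ix jx x~ix x~jx _ (fm , I≤m , m≤J , y~fm)
  with x ≟ᶠ y | position I≤m m≤J
... | yes refl | _                  = ix , ≤-refl , ≤-trans I≤m m≤J , x~ix , inj₁ (inj₁ refl)
... | no _     | inj₁ near-I        = fm , I≤m , m≤J , y~fm , inj₁ (near⇒close G p-path near-I)
... | no _     | inj₂ (inj₁ near-J) = fm , I≤m , m≤J , y~fm , inj₂ (near⇒close G p-path near-J)
... | no x≢y   | inj₂ (inj₂ (I+2≤m , m+2≤J)) =
  ⊥-elim (middle-neighbour-impossible G θ-free p-path D-anti x≢y x≁y
            (path-through G x~zx y~zy (walks zx zy zx∈D zy∈D))
            x~ix x~jx y~fm I+2≤m m+2≤J y~fi y~fj fi≢fj fi≁fj)
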